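{- Let $\mathcal{F}=\{F_1,\dots,F_n\}$ be a family of distinct sets with Venn diagram $\mathcal{V}=\{\tau_1,\dots,\tau_m\}$ and nerve $\mathcal{N}$, and let $\rho$ be a permutation of $[n]$. Let $w_\rho:\mathcal{V}\to[n]$ assign to each $\tau\in\mathcal{V}$ the element $x\in\tau$ with $\rho(x)$ minimal, and let $\mathcal{K}_\rho=\{\sigma\in\mathcal{N}:\ \text{for every nonempty }\vartheta\subseteq\sigma\text{ there is }\tau\in\mathcal{V}\text{ with }w_\rho(\tau)\in\vartheta\subseteq\tau\}$. Let $\Gamma_\rho$ be the $m\times n$ $0$-$1$ matrix whose entry in row $j$ and column $\rho(i)$ is $1$ if and only if $i\in\tau_j$. If $\tau\in\mathcal{K}_\rho$ and $\rho(\tau)=\{i_1,i_2,\dots,i_k\}$ with $i_1<i_2<\dots<i_k$, then for every $s\in\{1,2,\dots,k\}$ the matrix $\Gamma_\rho$ contains a row compatible with $\{i_s,i_{s+1},\dots,i_k\}$.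
   Context: Write $[n]=\{1,\dots,n\}$. For a nonempty $\tau\subseteq[n]$, the region of $\tau$ is $\mathrm{reg}(\tau)=\bigl(\bigcap_{i\in\tau}F_i\bigr)\setminus\bigl(\bigcup_{i\notin\tau}F_i\bigr)$. The Venn diagram is $\mathcal{V}=\{\tau\subseteq[n]:\tau\neq\emptyset,\ \mathrm{reg}(\tau)\neq\emptyset\}$ and the nerve is $\mathcal{N}=\{\sigma\subseteq[n]:\sigma\neq\emptyset,\ \bigcap_{i\in\sigma}F_i\neq\emptyset\}$. A row $R$ of $\Gamma_\rho$ is compatible with a nonempty set $I\subseteq[n]$ if $R$ has entry $1$ in every column with index in $I$ and entry $0$ in every column with index smaller than $\min(I)$. -}

module Defs where

open import Data.Nat using (ℕ)
open import Data.Bool using (Bool; true; false)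
open import Data.Fin using (Fin; _<_; _≤_)
open import Data.Fin.Subset using (Subset; _∈_; _∉_; _⊆_; Nonempty)
open import Data.Fin.Permutation using (Permutation′; _⟨$⟩ʳ_; _⟨$⟩ˡ_)
open import Data.Vec using (lookup)
open import Data.Product using (Σ; ∃; _×_)
open import Relation.Nullary using (¬_)
open import Relation.Binary.PropositionalEquality using (_≡_)
open import Function.Bundles using (_⇔_)

-- Indices [n] are represented 0-based by Fin n; subsets of [n] by Subset n.
-- A family F_1..F_n of sets is a map F : Fin n → (X → Set) for a universe X.

Distinct : {X : Set} {n : ℕ} → (Fin n → X → Set) → Set
Distinct {X} {n} F = ∀ i j → (∀ x → F i x ⇔ F j x) → i ≡ j

InRegion : {X : Set} {n : ℕ} → (Fin n → X → Set) → Subset n → X → Set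
InRegion F τ x = (∀ i → i ∈ τ → F i x) × (∀ i → i ∉ τ → ¬ F i x)

InVenn : {X : Set} {n : ℕ} → (Fin n → X → Set) → Subset n → Set
InVenn F τ = Nonempty τ × ∃ (InRegion F τ)

InNerve : {X : Set} {n : ℕ} → (Fin n → X → Set) → Subset n → Set
InNerve F σ = Nonempty σ × ∃ (λ x → ∀ i → i ∈ σ → F i x)

-- IsW ρ τ x : x = w_ρ(τ), i.e. x ∈ τ and ρ(x) is minimal among ρ(y), y ∈ τ
-- (ρ is injective, so this x is unique).
IsW : {n : ℕ} → Permutation′ n → Subset n → Fin n → Set
IsW ρ τ x = x ∈ τ × (∀ y → y ∈ τ → (ρ ⟨$⟩ʳ x) ≤ (ρ ⟨$⟩ʳ y))

InK : {X : Set} {n : ℕ} → (Fin n → X → Set) → Permutation′ n → Subset n → Set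
InK F ρ σ = InNerve F σ ×
  (∀ ϑ → Nonempty ϑ → ϑ ⊆ σ →
     ∃ λ τ → InVenn F τ × ∃ λ w → IsW ρ τ w × w ∈ ϑ × ϑ ⊆ τ)

-- The row of Γ_ρ corresponding to τ' ∈ 𝒱: the entry in column ρ(i) is 1 iff i ∈ τ',
-- i.e. the entry in column c is 1 iff ρ⁻¹(c) ∈ τ'.  The rows of Γ_ρ are exactly
-- the rows GammaRow ρ τ' for τ' ∈ 𝒱 (the order τ_1,…,τ_m is irrelevant here).
GammaRow : {n : ℕ} → Permutation′ n → Subset n → Fin n → Bool
GammaRow ρ τ' c = lookup τ' (ρ ⟨$⟩ˡ c)

-- A row R is compatible with a nonempty I ⊆ [n]: R is 1 on every column in I and 0 on
-- every column c < min(I) (for nonempty I, c < min I iff c < c' for all c' ∈ I).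
Compatible : {n : ℕ} → (Fin n → Bool) → (Fin n → Set) → Set
Compatible {n} R I = (∀ c → I c → R c ≡ true) × (∀ c → (∀ c' → I c' → c < c') → R c ≡ false)

Image : {n : ℕ} → Permutation′ n → Subset n → Fin n → Set
Image ρ τ c = (ρ ⟨$⟩ˡ c) ∈ τ

-- For a = i_s ∈ ρ(τ) = {i_1 < … < i_k}: the set {i_s, i_{s+1}, …, i_k} = {c ∈ ρ(τ) : a ≤ c}
Suffix : {n : ℕ} → Permutation′ n → Subset n → Fin n → Fin n → Set
Suffix ρ τ a c = Image ρ τ c × a ≤ c

-- Apply the defining property of 𝒦_ρ to ϑ = ρ⁻¹{i_s,…,i_k} ⊆ τ.  It yields τ' ∈ 𝒱 with
-- w = w_ρ(τ') ∈ ϑ ⊆ τ'.  The row of τ' is then 1 on {i_s,…,i_k} because ϑ ⊆ τ', and 0 on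
-- every column c < i_s because such a c lies left of ρ(w) ≥ i_s, the first 1 of that row.
module Submission where

open import Defs
open import Level using (Level)
open import Data.Nat using (ℕ)
open import Data.Nat.Properties using (<⇒≱)
open import Data.Bool using (true; false)
open import Data.Bool.Properties using (¬-not)
open import Data.Fin using (Fin; _<_; _≤_; _≤?_)
open import Data.Fin.Properties using (≤-refl)
open import Data.Fin.Subset using (Subset; _∈_; _∉_; _⊆_)
open import Data.Fin.Subset.Properties using (_∈?_)
open import Data.Fin.Permutation using (Permutation′; _⟨$⟩ʳ_; _⟨$⟩ˡ_; inverseˡ; inverseʳ)
open import Data.Vec using (tabulate; lookup)
open import Data.Vec.Properties using ([]=⇒lookup; lookup⇒[]=; lookup∘tabulate)
open import Data.Product using (∃; _×_; _,_)
open import Function using (_∘_)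
open import Relation.Nullary.Decidable using (does; yes; no; dec-true; _×-dec_)
open import Relation.Unary using (Pred; Decidable)
open import Relation.Binary.PropositionalEquality using (_≡_; sym; trans; subst)

private
  variable
    n : ℕ
    ℓ : Level

filter : {P : Pred (Fin n) ℓ} → Decidable P → Subset n
filter P? = tabulate (does ∘ P?)

module _ {P : Pred (Fin n) ℓ} (P? : Decidable P) where

  ∈-filter⁺ : ∀ {x} → P x → x ∈ filter P?
  ∈-filter⁺ {x} px = lookup⇒[]= x _ (trans (lookup∘tabulate _ x) (dec-true (P? x) px))

  ∈-filter⁻ : ∀ {x} → x ∈ filter P? → P x
  ∈-filter⁻ {x} x∈ with P? x | trans (sym (lookup∘tabulate _ x)) ([]=⇒lookup x∈)
  ... | yes px | _  = px
  ... | no _   | ()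

lookup-∉ : {p : Subset n} {x : Fin n} → x ∉ p → lookup p x ≡ false
lookup-∉ {p = p} {x} x∉p = ¬-not (x∉p ∘ lookup⇒[]= x p)

preimage : Permutation′ n → {P : Pred (Fin n) ℓ} → Decidable P → Subset n
preimage ρ P? = filter (P? ∘ (ρ ⟨$⟩ʳ_))

module _ (ρ : Permutation′ n) {P : Pred (Fin n) ℓ} (P? : Decidable P) where

  ∈-preimage⁺ : ∀ {c} → P c → ρ ⟨$⟩ˡ c ∈ preimage ρ P?
  ∈-preimage⁺ pc = ∈-filter⁺ (P? ∘ (ρ ⟨$⟩ʳ_)) (subst P (sym (inverseʳ ρ)) pc)

  ∈-preimage⁻ : ∀ {x} → x ∈ preimage ρ P? → P (ρ ⟨$⟩ʳ x)
  ∈-preimage⁻ = ∈-filter⁻ (P? ∘ (ρ ⟨$⟩ʳ_))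

suffix? : (ρ : Permutation′ n) (τ : Subset n) (a : Fin n) → Decidable (Suffix ρ τ a)
suffix? ρ τ a c = (ρ ⟨$⟩ˡ c ∈? τ) ×-dec (a ≤? c)

preimage-suffix⊆ : (ρ : Permutation′ n) (τ : Subset n) (a : Fin n) →
  preimage ρ (suffix? ρ τ a) ⊆ τ
preimage-suffix⊆ ρ τ a x∈ with ∈-preimage⁻ ρ (suffix? ρ τ a) x∈
... | ρx∈ρτ , _ = subst (_∈ τ) (inverseˡ ρ) ρx∈ρτ

GammaRow-<-w : (ρ : Permutation′ n) {τ' : Subset n} {w c : Fin n} →
  IsW ρ τ' w → c < ρ ⟨$⟩ʳ w → GammaRow ρ τ' c ≡ false
GammaRow-<-w ρ (_ , w-min) c<ρw =
  lookup-∉ λ ρ⁻¹c∈τ' → <⇒≱ c<ρw (subst (_ ≤_) (inverseʳ ρ) (w-min _ ρ⁻¹c∈τ'))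

lemma13 : {X : Set} {n : ℕ} (F : Fin n → X → Set) → Distinct F →
    (ρ : Permutation′ n) (τ : Subset n) → InK F ρ τ →
    (a : Fin n) → Image ρ τ a →
    ∃ λ τ' → InVenn F τ' × Compatible (GammaRow ρ τ') (Suffix ρ τ a)
lemma13 F _ ρ τ (_ , covered) a a∈ρτ
  with covered (preimage ρ (suffix? ρ τ a))
               (ρ ⟨$⟩ˡ a , ∈-preimage⁺ ρ (suffix? ρ τ a) (a∈ρτ , ≤-refl))
               (preimage-suffix⊆ ρ τ a)
... | τ' , τ'∈𝒱 , w , w-is-w , w∈ϑ , ϑ⊆τ' = τ' , τ'∈𝒱 , ones , zeros
  where
  ones : ∀ c → Suffix ρ τ a c → GammaRow ρ τ' c ≡ true
  ones c c∈suffix = []=⇒lookup (ϑ⊆τ' (∈-preimage⁺ ρ (suffix? ρ τ a) c∈suffix))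

  zeros : ∀ c → (∀ c' → Suffix ρ τ a c' → c < c') → GammaRow ρ τ' c ≡ false
  zeros c below-suffix =
    GammaRow-<-w ρ w-is-w (below-suffix _ (∈-preimage⁻ ρ (suffix? ρ τ a) w∈ϑ))
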